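{- Let $q$ be a prime power and $\delta,\varepsilon\in\mathbb F_q^*$ with $\delta^2\varepsilon\neq1$ and $\delta^3\varepsilon^2+(1-3\delta)\varepsilon+1\neq0$. Then the plane curve $\mathcal Q: f(X,Y)=0$ has no linear components, where $$\begin{aligned}f(X,Y)=\;&X^2Y^2(1-\delta^2\varepsilon)(\delta\varepsilon-1)+XY(X+Y)(\delta^2\varepsilon+\delta\varepsilon-2)(\delta^2\varepsilon-1)-(X^2+Y^2)(\delta^2\varepsilon-1)^2\\&+XY(\delta^6\varepsilon^3-5\delta^4\varepsilon^2+6\delta^2\varepsilon+\delta\varepsilon+\delta-4)+(X+Y)(\delta^2\varepsilon-1)(\delta^2\varepsilon+\delta-2)+(\delta-1)(1-\delta^2\varepsilon).\end{aligned}$$ -}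

module Defs where

open import Level using (Level; _⊔_)
open import Algebra.Bundles using (CommutativeRing)
open import Data.Nat using (ℕ; zero; suc; _<_; _≤_)
open import Data.Nat.Primality using (Prime)
open import Data.List using (List; []; _∷_; _++_; [_]; length)
open import Data.Product using (∃; ∃-syntax; _×_; _,_)
open import Data.Sum using (_⊎_)
open import Relation.Nullary using (¬_)

record Field (c ℓ : Level) : Set (Level.suc (c ⊔ ℓ)) where
  field
    commutativeRing : CommutativeRing c ℓ
  open CommutativeRing commutativeRing public
  field
    1≉0     : ¬ (1# ≈ 0#)
    inverse : ∀ x → ¬ (x ≈ 0#) → ∃[ y ] (x * y ≈ 1#)

module FieldNotions {c ℓ : Level} (K : Field c ℓ) where
  open Field K

  nat : ℕ → Carrier
  nat zero    = 0#
  nat (suc n) = 1# + nat n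

  pow : Carrier → ℕ → Carrier
  pow x zero    = 1#
  pow x (suc n) = x * pow x n

  HasCharacteristic : ℕ → Set ℓ
  HasCharacteristic p = nat p ≈ 0#

  -- Univariate polynomials as coefficient lists [c₀, c₁, …] (c₀ + c₁ t + …);
  -- evaluation by Horner's rule.
  eval : List Carrier → Carrier → Carrier
  eval []       t = 0#
  eval (a ∷ as) t = a + t * eval as t

  -- K is algebraically closed: every monic polynomial of degree ≥ 1
  -- (coefficients cs followed by leading coefficient 1) has a root in K.
  AlgebraicallyClosed : Set (c ⊔ ℓ)
  AlgebraicallyClosed =
    ∀ (cs : List Carrier) → 1 ≤ length cs → ∃[ t ] (eval (cs ++ [ 1# ]) t ≈ 0#)

  -- Bivariate polynomials over K, given by their coefficient functions:
  -- P i j is the coefficient of X^i Y^j; a polynomial has finite support.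
  Poly₂ : Set c
  Poly₂ = ℕ → ℕ → Carrier

  FiniteSupport : Poly₂ → Set ℓ
  FiniteSupport P = ∃[ N ] (∀ i j → (N < i ⊎ N < j) → P i j ≈ 0#)

  -- coefficients of the product (a X + b Y + c) · G
  linTimes : Carrier → Carrier → Carrier → Poly₂ → Poly₂
  linTimes a b c₀ G i j = (aPart i) + ((bPart j) + c₀ * G i j)
    where
      aPart : ℕ → Carrier
      aPart zero    = 0#
      aPart (suc i) = a * G i j
      bPart : ℕ → Carrier
      bPart zero    = 0#
      bPart (suc j) = b * G i j

  _≋_ : Poly₂ → Poly₂ → Set ℓ
  P ≋ Q = ∀ i j → P i j ≈ Q i j

  -- The curve F = 0 has a linear component (over K): F is divisible in K[X,Y]
  -- by a polynomial a X + b Y + c of degree one, i.e. (a , b) ≠ (0 , 0).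
  HasLinearComponent : Poly₂ → Set (c ⊔ ℓ)
  HasLinearComponent F =
    ∃[ a ] ∃[ b ] ∃[ c₀ ] ∃[ G ]
      (¬ (a ≈ 0# × b ≈ 0#) × FiniteSupport G × (F ≋ linTimes a b c₀ G))

  fQ : Carrier → Carrier → Poly₂
  fQ δ ε = coeff
    where
      d2e = δ * δ * ε
      coeff : Poly₂
      coeff 2 2 = (1# - d2e) * (δ * ε - 1#)
      coeff 2 1 = (d2e + δ * ε - nat 2) * (d2e - 1#)
      coeff 1 2 = (d2e + δ * ε - nat 2) * (d2e - 1#)
      coeff 2 0 = - ((d2e - 1#) * (d2e - 1#))
      coeff 0 2 = - ((d2e - 1#) * (d2e - 1#))
      coeff 1 1 = pow δ 6 * pow ε 3 - nat 5 * (pow δ 4 * pow ε 2)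
                  + nat 6 * (pow δ 2 * ε) + δ * ε + δ - nat 4
      coeff 1 0 = (d2e - 1#) * (d2e + δ - nat 2)
      coeff 0 1 = (d2e - 1#) * (d2e + δ - nat 2)
      coeff 0 0 = (δ - 1#) * (1# - d2e)
      coeff _ _ = 0#

{-# OPTIONS --safe #-}
module Submission where

-- A linear component a X + b Y + c of 𝒬 makes the evaluation F of f vanish along the
-- line.  Since F(x,1) = δ³εH·x with H the second excluded expression, a line with a ≠ 0
-- meets Y = 1 only at x = 0, so b + c = 0, and by the symmetry of f also a + c = 0
-- when b ≠ 0.  Hence, up to symmetry, the line is X = 0 or X + Y = 1.  On them,
-- F(0, 1 - s) = -D s (D s + δ - 1 - D) and F(x, 1 - x) = -s (α s + β) with s = x² - x,
-- where D = δ²ε - 1 ≠ 0.  As x ↦ x² - x is onto over an algebraically closed field, such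
-- a quadratic in s vanishes identically.  So D = 0, resp. α = D (δε - 1) = 0, forcing
-- δε = 1, and then β = δ (δ - 1)² = 0 gives δ = 1, i.e. again D = 0.

open import Defs
open import Level using (Level; _⊔_)
open import Data.Nat.Primality using (Prime)
open import Relation.Nullary using (¬_)

open import Algebra.Bundles using (CommutativeRing)
open import Algebra.Solver.Ring.AlmostCommutativeRing
  using (_-Raw-AlmostCommutative⟶_; fromCommutativeRing)
open import Data.Integer.Base as ℤ using (ℤ; +_; -[1+_]; _⊖_)
import Data.Integer.Properties as ℤ
open import Data.Maybe.Base using (Maybe; just; nothing)
open import Data.Nat.Base as ℕ using (ℕ; zero; suc; _≤_; _≤′_; ≤′-refl; ≤′-step; _^_)
import Data.Nat.Properties as ℕ
open import Data.List.Base using ([]; _∷_)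
open import Data.Product using (∃-syntax; _×_; _,_; proj₁; proj₂)
open import Data.Sign.Base as Sign using (Sign)
open import Data.Sum.Base as Sum using (_⊎_; inj₁; inj₂)
open import Function.Base using (_∘_)
open import Relation.Nullary.Decidable.Core using (yes; no; ¬¬-excluded-middle)
import Relation.Binary.PropositionalEquality as ≡

module IntegerCoefficientSolver {c ℓ} (R : CommutativeRing c ℓ) where
  open CommutativeRing R
  open import Algebra.Properties.Ring ring
    using (-0#≈0#; -‿involutive; -‿+-comm; xyx⁻¹≈y; -1*x≈-x)
  open import Algebra.Properties.Semiring.Mult.TCOptimised semiring
    using (1+×; ×-homo-+; ×1-homo-*) renaming (_×_ to _·_)
  open import Algebra.Properties.CommutativeSemigroup *-commutativeSemigroup
    using (interchange)
  open import Relation.Binary.Reasoning.Setoid setoid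

  -- The optimised multiples make 1 · 1# definitionally 1#, so that the constant
  -- con (+ 1) of the solver evaluates to 1# on the nose.
  ⟦_⟧ℤ : ℤ → Carrier
  ⟦ + n      ⟧ℤ = n · 1#
  ⟦ -[1+ n ] ⟧ℤ = - (suc n · 1#)

  ⊖-homo : ∀ m n → ⟦ m ⊖ n ⟧ℤ ≈ m · 1# - n · 1#
  ⊖-homo m       zero    = sym (trans (+-congˡ -0#≈0#) (+-identityʳ _))
  ⊖-homo zero    (suc n) = sym (+-identityˡ _)
  ⊖-homo (suc m) (suc n) = begin
    ⟦ suc m ⊖ suc n ⟧ℤ                   ≡⟨ ≡.cong ⟦_⟧ℤ (ℤ.[1+m]⊖[1+n]≡m⊖n m n) ⟩
    ⟦ m ⊖ n ⟧ℤ                           ≈⟨ ⊖-homo m n ⟩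
    m · 1# - n · 1#                      ≈⟨ +-congʳ (xyx⁻¹≈y 1# (m · 1#)) ⟨
    (1# + m · 1#) - 1# - n · 1#          ≈⟨ +-assoc _ _ _ ⟩
    (1# + m · 1#) + (- 1# - n · 1#)      ≈⟨ +-congˡ (-‿+-comm 1# (n · 1#)) ⟩
    (1# + m · 1#) - (1# + n · 1#)        ≈⟨ +-cong (1+× m 1#) (-‿cong (1+× n 1#)) ⟨
    suc m · 1# - suc n · 1#              ∎

  +-homo : ∀ i j → ⟦ i ℤ.+ j ⟧ℤ ≈ ⟦ i ⟧ℤ + ⟦ j ⟧ℤ
  +-homo (+ m)    (+ n)    = ×-homo-+ 1# m n
  +-homo (+ m)    -[1+ n ] = ⊖-homo m (suc n)
  +-homo -[1+ m ] (+ n)    = trans (⊖-homo n (suc m)) (+-comm _ _)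
  +-homo -[1+ m ] -[1+ n ] = begin
    - (suc (suc (m ℕ.+ n)) · 1#)          ≡⟨ ≡.cong (λ k → - (k · 1#)) (ℕ.+-suc (suc m) n) ⟨
    - ((suc m ℕ.+ suc n) · 1#)            ≈⟨ -‿cong (×-homo-+ 1# (suc m) (suc n)) ⟩
    - (suc m · 1# + suc n · 1#)           ≈⟨ -‿+-comm _ _ ⟨
    - (suc m · 1#) - suc n · 1#           ∎

  ⟦_⟧± : Sign → Carrier
  ⟦ Sign.+ ⟧± = 1#
  ⟦ Sign.- ⟧± = - 1#

  sign-homo : ∀ s t → ⟦ s Sign.* t ⟧± ≈ ⟦ s ⟧± * ⟦ t ⟧±
  sign-homo Sign.+ t      = sym (*-identityˡ _)
  sign-homo Sign.- Sign.+ = sym (*-identityʳ _)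
  sign-homo Sign.- Sign.- = sym (trans (-1*x≈-x (- 1#)) (-‿involutive 1#))

  ◃-homo : ∀ s n → ⟦ s ℤ.◃ n ⟧ℤ ≈ ⟦ s ⟧± * (n · 1#)
  ◃-homo s      zero    = sym (zeroʳ _)
  ◃-homo Sign.+ (suc n) = sym (*-identityˡ _)
  ◃-homo Sign.- (suc n) = sym (-1*x≈-x _)

  sign-abs : ∀ i → ⟦ i ⟧ℤ ≈ ⟦ ℤ.sign i ⟧± * (ℤ.∣ i ∣ · 1#)
  sign-abs i = trans (reflexive (≡.cong ⟦_⟧ℤ (≡.sym (ℤ.◃-inverse i)))) (◃-homo (ℤ.sign i) ℤ.∣ i ∣)

  *-homo : ∀ i j → ⟦ i ℤ.* j ⟧ℤ ≈ ⟦ i ⟧ℤ * ⟦ j ⟧ℤ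
  *-homo i j = begin
    ⟦ (ℤ.sign i Sign.* ℤ.sign j) ℤ.◃ (ℤ.∣ i ∣ ℕ.* ℤ.∣ j ∣) ⟧ℤ
      ≈⟨ ◃-homo (ℤ.sign i Sign.* ℤ.sign j) (ℤ.∣ i ∣ ℕ.* ℤ.∣ j ∣) ⟩
    ⟦ ℤ.sign i Sign.* ℤ.sign j ⟧± * ((ℤ.∣ i ∣ ℕ.* ℤ.∣ j ∣) · 1#)
      ≈⟨ *-cong (sign-homo (ℤ.sign i) (ℤ.sign j)) (×1-homo-* ℤ.∣ i ∣ ℤ.∣ j ∣) ⟩
    (⟦ ℤ.sign i ⟧± * ⟦ ℤ.sign j ⟧±) * (ℤ.∣ i ∣ · 1# * ℤ.∣ j ∣ · 1#)
      ≈⟨ interchange _ _ _ _ ⟩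
    (⟦ ℤ.sign i ⟧± * ℤ.∣ i ∣ · 1#) * (⟦ ℤ.sign j ⟧± * ℤ.∣ j ∣ · 1#)
      ≈⟨ *-cong (sign-abs i) (sign-abs j) ⟨
    ⟦ i ⟧ℤ * ⟦ j ⟧ℤ
      ∎

  -‿homo : ∀ i → ⟦ ℤ.- i ⟧ℤ ≈ - ⟦ i ⟧ℤ
  -‿homo (+ zero)  = sym -0#≈0#
  -‿homo (+ suc n) = refl
  -‿homo -[1+ n ]  = sym (-‿involutive _)

  ℤ-homomorphism : ℤ.+-*-rawRing -Raw-AlmostCommutative⟶ fromCommutativeRing R
  ℤ-homomorphism = record
    { ⟦_⟧    = ⟦_⟧ℤ
    ; +-homo = +-homo
    ; *-homo = *-homo
    ; -‿homo = -‿homo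
    ; 0-homo = refl
    ; 1-homo = refl
    }

  ⟦⟧ℤ-≟ : ∀ i j → Maybe (⟦ i ⟧ℤ ≈ ⟦ j ⟧ℤ)
  ⟦⟧ℤ-≟ i j with i ℤ.≟ j
  ... | yes ≡.refl = just refl
  ... | no _       = nothing

  open import Algebra.Solver.Ring ℤ.+-*-rawRing (fromCommutativeRing R) ℤ-homomorphism ⟦⟧ℤ-≟ public

  0ₚ 1ₚ : ∀ {n} → Polynomial n
  0ₚ = con (+ 0)
  1ₚ = con (+ 1)

module Horner {c ℓ} (R : CommutativeRing c ℓ) where
  open CommutativeRing R
  open IntegerCoefficientSolver R using (solve; _:=_; _:+_; _:*_)
  open import Relation.Binary.Reasoning.Setoid setoid

  horner : ℕ → (ℕ → Carrier) → Carrier → Carrier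
  horner zero    g t = 0#
  horner (suc n) g t = g 0 + t * horner n (g ∘ suc) t

  shift : (ℕ → Carrier) → ℕ → Carrier
  shift g zero    = 0#
  shift g (suc j) = g j

  horner-cong : ∀ n {g h} t → (∀ j → g j ≈ h j) → horner n g t ≈ horner n h t
  horner-cong zero    t g≈h = refl
  horner-cong (suc n) t g≈h = +-cong (g≈h 0) (*-congˡ (horner-cong n t (g≈h ∘ suc)))

  horner-zero : ∀ n {g} t → (∀ j → g j ≈ 0#) → horner n g t ≈ 0#
  horner-zero zero    t g≈0 = refl
  horner-zero (suc n) t g≈0 =
    trans (+-cong (g≈0 0) (*-congˡ (horner-zero n t (g≈0 ∘ suc))))
          (trans (+-identityˡ _) (zeroʳ t))

  horner-+ : ∀ n g h t → horner n (λ j → g j + h j) t ≈ horner n g t + horner n h t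
  horner-+ zero    g h t = sym (+-identityʳ 0#)
  horner-+ (suc n) g h t =
    trans (+-congˡ (*-congˡ (horner-+ n (g ∘ suc) (h ∘ suc) t)))
          (solve 5 (λ a b t p q → (a :+ b) :+ t :* (p :+ q) := (a :+ t :* p) :+ (b :+ t :* q))
                 refl (g 0) (h 0) t _ _)

  horner-*ˡ : ∀ n k g t → horner n (λ j → k * g j) t ≈ k * horner n g t
  horner-*ˡ zero    k g t = sym (zeroʳ k)
  horner-*ˡ (suc n) k g t =
    trans (+-congˡ (*-congˡ (horner-*ˡ n k (g ∘ suc) t)))
          (solve 4 (λ k a t p → k :* a :+ t :* (k :* p) := k :* (a :+ t :* p)) refl k (g 0) t _)

  horner-drop : ∀ n {g} t → g n ≈ 0# → horner (suc n) g t ≈ horner n g t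
  horner-drop zero    t g₀≈0 = trans (+-cong g₀≈0 (zeroʳ t)) (+-identityˡ 0#)
  horner-drop (suc n) t gₙ≈0 = +-congˡ (*-congˡ (horner-drop n t gₙ≈0))

  horner-stable : ∀ {n m g} t → (∀ j → n ≤ j → g j ≈ 0#) → n ≤′ m → horner m g t ≈ horner n g t
  horner-stable t g≈0 ≤′-refl = refl
  horner-stable t g≈0 (≤′-step {m} n≤′m) =
    trans (horner-drop m t (g≈0 m (ℕ.≤′⇒≤ n≤′m))) (horner-stable t g≈0 n≤′m)

  horner-shift : ∀ n g t → g n ≈ 0# → horner (suc n) (shift g) t ≈ t * horner (suc n) g t
  horner-shift n g t gₙ≈0 = begin
    0# + t * horner n g t      ≈⟨ +-identityˡ _ ⟩
    t * horner n g t           ≈⟨ *-congˡ (horner-drop n t gₙ≈0) ⟨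
    t * horner (suc n) g t     ∎

module FieldProperties {c ℓ} (K : Field c ℓ) where
  open Field K
  open FieldNotions K using (AlgebraicallyClosed)
  open IntegerCoefficientSolver commutativeRing
  open import Algebra.Properties.Ring ring using (-0#≈0#; -‿injective)
  open import Relation.Binary.Reasoning.Setoid setoid

  x*y≈1⇒x≉0 : ∀ {x y} → x * y ≈ 1# → ¬ x ≈ 0#
  x*y≈1⇒x≉0 {x} {y} x*y≈1 x≈0 = 1≉0 (begin
    1#      ≈⟨ x*y≈1 ⟨
    x * y   ≈⟨ *-congʳ x≈0 ⟩
    0# * y  ≈⟨ zeroˡ y ⟩
    0#      ∎)

  *-cancelˡ-≉0 : ∀ {x y} → ¬ x ≈ 0# → x * y ≈ 0# → y ≈ 0#
  *-cancelˡ-≉0 {x} {y} x≉0 x*y≈0 = begin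
    y                ≈⟨ solve 3 (λ x x⁻¹ y → y := x⁻¹ :* (x :* y) :+ (1ₚ :- x :* x⁻¹) :* y) refl x x⁻¹ y ⟩
    x⁻¹ * (x * y) + (1# - x * x⁻¹) * y
      ≈⟨ +-cong (*-congˡ x*y≈0) (*-congʳ (+-congˡ (-‿cong x*x⁻¹≈1))) ⟩
    x⁻¹ * 0# + (1# - 1#) * y
      ≈⟨ solve 2 (λ x⁻¹ y → x⁻¹ :* 0ₚ :+ (1ₚ :- 1ₚ) :* y := 0ₚ) refl x⁻¹ y ⟩
    0#               ∎
    where
    x⁻¹ = proj₁ (inverse x x≉0)
    x*x⁻¹≈1 = proj₂ (inverse x x≉0)

  *-≉0 : ∀ {x y} → ¬ x ≈ 0# → ¬ y ≈ 0# → ¬ x * y ≈ 0#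
  *-≉0 x≉0 y≉0 = y≉0 ∘ *-cancelˡ-≉0 x≉0

  -x≈0⇒x≈0 : ∀ {x} → - x ≈ 0# → x ≈ 0#
  -x≈0⇒x≈0 -x≈0 = -‿injective (trans -x≈0 (sym -0#≈0#))

  line-meets-every-horizontal : ∀ {a} b c y → ¬ a ≈ 0# → ∃[ x ] (a * x + b * y + c ≈ 0#)
  line-meets-every-horizontal {a} b c y a≉0 = - ((b * y + c) * a⁻¹) , (begin
    a * - ((b * y + c) * a⁻¹) + b * y + c
      ≈⟨ solve 5 (λ a b c y a⁻¹ → a :* :- ((b :* y :+ c) :* a⁻¹) :+ b :* y :+ c
                                  := (b :* y :+ c) :* (1ₚ :- a :* a⁻¹)) refl a b c y a⁻¹ ⟩
    (b * y + c) * (1# - a * a⁻¹)  ≈⟨ *-congˡ (+-congˡ (-‿cong a*a⁻¹≈1)) ⟩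
    (b * y + c) * (1# - 1#)       ≈⟨ solve 1 (λ k → k :* (1ₚ :- 1ₚ) := 0ₚ) refl _ ⟩
    0#                            ∎)
    where
    a⁻¹ = proj₁ (inverse a a≉0)
    a*a⁻¹≈1 = proj₂ (inverse a a≉0)

  x²-x-surjective : AlgebraicallyClosed → ∀ s → ∃[ x ] (x * x - x ≈ s)
  x²-x-surjective closed s with closed (- s ∷ - 1# ∷ []) (ℕ.s≤s ℕ.z≤n)
  ... | x , root = x , (begin
    x * x - x
      ≈⟨ solve 2 (λ s x → x :* x :- x := (:- s :+ x :* (:- 1ₚ :+ x :* (1ₚ :+ x :* 0ₚ))) :+ s) refl s x ⟩
    (- s + x * (- 1# + x * (1# + x * 0#))) + s  ≈⟨ +-congʳ root ⟩
    0# + s                                      ≈⟨ +-identityˡ s ⟩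
    s                                           ∎)

  vanishing-quadratic : AlgebraicallyClosed → ∀ {α β} →
                        (∀ s → s * (α * s + β) ≈ 0#) → α ≈ 0# × β ≈ 0#
  vanishing-quadratic closed {α} {β} vanishes = α≈0 , β≈0
    where
    t = proj₁ (x²-x-surjective closed 1#)

    t*[t-1]≈1 : t * (t - 1#) ≈ 1#
    t*[t-1]≈1 = trans (solve 1 (λ t → t :* (t :- 1ₚ) := t :* t :- t) refl t)
                      (proj₂ (x²-x-surjective closed 1#))

    α+β≈0 : α + β ≈ 0#
    α+β≈0 = trans (solve 2 (λ α β → α :+ β := 1ₚ :* (α :* 1ₚ :+ β)) refl α β) (vanishes 1#)

    αt+β≈0 : α * t + β ≈ 0#
    αt+β≈0 = *-cancelˡ-≉0 (x*y≈1⇒x≉0 t*[t-1]≈1) (vanishes t)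

    α≈0 : α ≈ 0#
    α≈0 = *-cancelˡ-≉0 (x*y≈1⇒x≉0 (trans (*-comm _ _) t*[t-1]≈1)) (begin
      (t - 1#) * α             ≈⟨ solve 3 (λ α β t → (t :- 1ₚ) :* α := (α :* t :+ β) :- (α :+ β)) refl α β t ⟩
      (α * t + β) - (α + β)    ≈⟨ +-cong αt+β≈0 (-‿cong α+β≈0) ⟩
      0# - 0#                  ≈⟨ -‿inverseʳ 0# ⟩
      0#                       ∎)

    β≈0 : β ≈ 0#
    β≈0 = begin
      β              ≈⟨ solve 2 (λ α β → β := (α :+ β) :- α) refl α β ⟩
      (α + β) - α    ≈⟨ +-cong α+β≈0 (-‿cong α≈0) ⟩
      0# - 0#        ≈⟨ -‿inverseʳ 0# ⟩
      0#             ∎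

module BivariateEvaluation {c ℓ} (K : Field c ℓ) where
  open Field K
  open FieldNotions K
  open Horner commutativeRing
  open IntegerCoefficientSolver commutativeRing using (solve; _:=_; _:+_; _:*_)
  open import Relation.Binary.Reasoning.Setoid setoid

  eval₂ : ℕ → Poly₂ → Carrier → Carrier → Carrier
  eval₂ n P x y = horner n (λ i → horner n (P i) y) x

  SupportedBelow : ℕ → Poly₂ → Set ℓ
  SupportedBelow n P = ∀ i j → n ≤ i ⊎ n ≤ j → P i j ≈ 0#

  eval₂-cong : ∀ n {P Q} x y → P ≋ Q → eval₂ n P x y ≈ eval₂ n Q x y
  eval₂-cong n x y P≋Q = horner-cong n x (λ i → horner-cong n y (P≋Q i))

  eval₂-stable : ∀ {n m P} x y → SupportedBelow n P → n ≤′ m → eval₂ m P x y ≈ eval₂ n P x y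
  eval₂-stable {n} {m} {P} x y P↓n n≤′m = begin
    horner m (λ i → horner m (P i) y) x
      ≈⟨ horner-cong m x (λ i → horner-stable y (λ j n≤j → P↓n i j (inj₂ n≤j)) n≤′m) ⟩
    horner m (λ i → horner n (P i) y) x
      ≈⟨ horner-stable x (λ i n≤i → horner-zero n y (λ j → P↓n i j (inj₁ n≤i))) n≤′m ⟩
    horner n (λ i → horner n (P i) y) x
      ∎

  module _ (a b c₀ : Carrier) (G : Poly₂) (n : ℕ) (G↓n : SupportedBelow n G) (x y : Carrier) where
    private
      m = suc n

      aXG bYG c₀G : Poly₂
      aXG i j = shift (λ i → a * G i j) i
      bYG i   = shift (λ j → b * G i j)
      c₀G i j = c₀ * G i j

      R : ℕ → Carrier
      R i = horner m (G i) y

    linTimes-split : ∀ i j → linTimes a b c₀ G i j ≈ aXG i j + (bYG i j + c₀G i j)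
    linTimes-split zero    zero    = refl
    linTimes-split zero    (suc j) = refl
    linTimes-split (suc i) zero    = refl
    linTimes-split (suc i) (suc j) = refl

    horner-aXG-row : ∀ i → horner m (aXG i) y ≈ shift (λ i → a * R i) i
    horner-aXG-row zero    = horner-zero m y (λ _ → refl)
    horner-aXG-row (suc i) = horner-*ˡ m a (G i) y

    horner-bYG-row : ∀ i → horner m (bYG i) y ≈ y * (b * R i)
    horner-bYG-row i = begin
      horner m (bYG i) y                 ≈⟨ horner-shift n (λ j → b * G i j) y b*Gᵢₙ≈0 ⟩
      y * horner m (λ j → b * G i j) y   ≈⟨ *-congˡ (horner-*ˡ m b (G i) y) ⟩
      y * (b * R i)                      ∎
      where
      b*Gᵢₙ≈0 = trans (*-congˡ (G↓n i n (inj₂ ℕ.≤-refl))) (zeroʳ b)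

    horner-linTimes-row : ∀ i → horner m (linTimes a b c₀ G i) y
                                ≈ shift (λ i → a * R i) i + (y * (b * R i) + c₀ * R i)
    horner-linTimes-row i = begin
      horner m (linTimes a b c₀ G i) y
        ≈⟨ horner-cong m y (linTimes-split i) ⟩
      horner m (λ j → aXG i j + (bYG i j + c₀G i j)) y
        ≈⟨ horner-+ m (aXG i) (λ j → bYG i j + c₀G i j) y ⟩
      horner m (aXG i) y + horner m (λ j → bYG i j + c₀G i j) y
        ≈⟨ +-congˡ (horner-+ m (bYG i) (c₀G i) y) ⟩
      horner m (aXG i) y + (horner m (bYG i) y + horner m (c₀G i) y)
        ≈⟨ +-cong (horner-aXG-row i) (+-cong (horner-bYG-row i) (horner-*ˡ m c₀ (G i) y)) ⟩
      shift (λ i → a * R i) i + (y * (b * R i) + c₀ * R i)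
        ∎

    eval₂-linTimes : eval₂ m (linTimes a b c₀ G) x y ≈ (a * x + b * y + c₀) * eval₂ m G x y
    eval₂-linTimes = begin
      horner m (λ i → horner m (linTimes a b c₀ G i) y) x
        ≈⟨ horner-cong m x horner-linTimes-row ⟩
      horner m (λ i → shift aR i + (y * (b * R i) + c₀ * R i)) x
        ≈⟨ horner-+ m (shift aR) (λ i → y * (b * R i) + c₀ * R i) x ⟩
      horner m (shift aR) x + horner m (λ i → y * (b * R i) + c₀ * R i) x
        ≈⟨ +-congˡ (horner-+ m (λ i → y * (b * R i)) (λ i → c₀ * R i) x) ⟩
      horner m (shift aR) x + (horner m (λ i → y * (b * R i)) x + horner m (λ i → c₀ * R i) x)
        ≈⟨ +-cong (horner-shift n aR x a*Rₙ≈0)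
                  (+-cong (horner-*ˡ m y (λ i → b * R i) x) (horner-*ˡ m c₀ R x)) ⟩
      x * horner m aR x + (y * horner m (λ i → b * R i) x + c₀ * E)
        ≈⟨ +-cong (*-congˡ (horner-*ˡ m a R x)) (+-congʳ (*-congˡ (horner-*ˡ m b R x))) ⟩
      x * (a * E) + (y * (b * E) + c₀ * E)
        ≈⟨ solve 6 (λ a b c x y e → x :* (a :* e) :+ (y :* (b :* e) :+ c :* e) := (a :* x :+ b :* y :+ c) :* e)
                 refl a b c₀ x y E ⟩
      (a * x + b * y + c₀) * E
        ∎
      where
      E = eval₂ m G x y
      aR = λ i → a * R i
      a*Rₙ≈0 = trans (*-congˡ (horner-zero m y (λ j → G↓n n j (inj₁ ℕ.≤-refl)))) (zeroʳ a)

  vanishes-on-linear-component : ∀ {n F} → SupportedBelow n F → HasLinearComponent F →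
    ∃[ a ] ∃[ b ] ∃[ c₀ ] (¬ (a ≈ 0# × b ≈ 0#) × (∀ x y → a * x + b * y + c₀ ≈ 0# → eval₂ n F x y ≈ 0#))
  vanishes-on-linear-component {n} {F} F↓n (a , b , c₀ , G , ab≉0 , (N , G↓) , F≋linTimes) =
    a , b , c₀ , ab≉0 , vanishes
    where
    k = suc N ℕ.+ n

    G↓k : SupportedBelow k G
    G↓k i j = G↓ i j ∘ Sum.map (ℕ.≤-trans (ℕ.m≤m+n (suc N) n)) (ℕ.≤-trans (ℕ.m≤m+n (suc N) n))

    vanishes : ∀ x y → a * x + b * y + c₀ ≈ 0# → eval₂ n F x y ≈ 0#
    vanishes x y on-line = begin
      eval₂ n F x y                         ≈⟨ eval₂-stable x y F↓n (ℕ.≤⇒≤′ (ℕ.m≤n+m n (suc (suc N)))) ⟨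
      eval₂ (suc k) F x y                   ≈⟨ eval₂-cong (suc k) x y F≋linTimes ⟩
      eval₂ (suc k) (linTimes a b c₀ G) x y ≈⟨ eval₂-linTimes a b c₀ G k G↓k x y ⟩
      (a * x + b * y + c₀) * E              ≈⟨ *-congʳ on-line ⟩
      0# * E                                ≈⟨ zeroˡ E ⟩
      0#                                    ∎
      where E = eval₂ (suc k) G x y

module CurveQ {c ℓ} (K : Field c ℓ) (δ ε : Field.Carrier K) where
  open Field K
  open FieldNotions K
  open BivariateEvaluation K
  open IntegerCoefficientSolver commutativeRing

  fQ-supportedBelow-3 : SupportedBelow 3 (fQ δ ε)
  fQ-supportedBelow-3 _ _ (inj₁ (ℕ.s≤s (ℕ.s≤s (ℕ.s≤s _)))) = refl
  fQ-supportedBelow-3 0 _ (inj₂ (ℕ.s≤s (ℕ.s≤s (ℕ.s≤s _)))) = refl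
  fQ-supportedBelow-3 1 _ (inj₂ (ℕ.s≤s (ℕ.s≤s (ℕ.s≤s _)))) = refl
  fQ-supportedBelow-3 2 _ (inj₂ (ℕ.s≤s (ℕ.s≤s (ℕ.s≤s _)))) = refl
  fQ-supportedBelow-3 (suc (suc (suc _))) _ (inj₂ _)         = refl

  F : Carrier → Carrier → Carrier
  F = eval₂ 3 (fQ δ ε)

  D u w H c₁ γ α β : Carrier
  D  = δ * δ * ε - 1#
  u  = δ * ε - 1#
  w  = δ - 1#
  H  = pow δ 3 * pow ε 2 + (1# - nat 3 * δ) * ε + 1#
  c₁ = pow δ 3 * ε * H
  γ  = δ * (δ * ε - nat 2 * δ * (δ * ε + 1#) + δ * δ * (δ * ε * (δ * ε) + δ * ε + 1#))
  α  = D * u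
  -- β ≡ δ (δ - 1)² modulo u = δε - 1, with cofactor γ.
  β  = δ * w * w + u * γ

  -- Syntactic copies of fQ and of the quantities above for the ring solver; their
  -- evaluations are definitionally the terms they copy.
  private module Syntax {k : ℕ} where
    natₚ : ℕ → Polynomial k
    natₚ zero    = 0ₚ
    natₚ (suc n) = 1ₚ :+ natₚ n

    powₚ : Polynomial k → ℕ → Polynomial k
    powₚ p zero    = 1ₚ
    powₚ p (suc n) = p :* powₚ p n

    hornerₚ : ℕ → (ℕ → Polynomial k) → Polynomial k → Polynomial k
    hornerₚ zero    g t = 0ₚ
    hornerₚ (suc n) g t = g 0 :+ t :* hornerₚ n (g ∘ suc) t

    fQₚ : Polynomial k → Polynomial k → ℕ → ℕ → Polynomial k
    fQₚ d e 2 2 = (1ₚ :- d :* d :* e) :* (d :* e :- 1ₚ)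
    fQₚ d e 2 1 = (d :* d :* e :+ d :* e :- natₚ 2) :* (d :* d :* e :- 1ₚ)
    fQₚ d e 1 2 = (d :* d :* e :+ d :* e :- natₚ 2) :* (d :* d :* e :- 1ₚ)
    fQₚ d e 2 0 = :- ((d :* d :* e :- 1ₚ) :* (d :* d :* e :- 1ₚ))
    fQₚ d e 0 2 = :- ((d :* d :* e :- 1ₚ) :* (d :* d :* e :- 1ₚ))
    fQₚ d e 1 1 = powₚ d 6 :* powₚ e 3 :- natₚ 5 :* (powₚ d 4 :* powₚ e 2)
                  :+ natₚ 6 :* (powₚ d 2 :* e) :+ d :* e :+ d :- natₚ 4
    fQₚ d e 1 0 = (d :* d :* e :- 1ₚ) :* (d :* d :* e :+ d :- natₚ 2)
    fQₚ d e 0 1 = (d :* d :* e :- 1ₚ) :* (d :* d :* e :+ d :- natₚ 2)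
    fQₚ d e 0 0 = (d :- 1ₚ) :* (1ₚ :- d :* d :* e)
    fQₚ d e _ _ = 0ₚ

    Fₚ : Polynomial k → Polynomial k → Polynomial k → Polynomial k → Polynomial k
    Fₚ d e x y = hornerₚ 3 (λ i → hornerₚ 3 (fQₚ d e i) y) x

    Dₚ uₚ wₚ Hₚ c₁ₚ γₚ αₚ βₚ : Polynomial k → Polynomial k → Polynomial k
    Dₚ d e  = d :* d :* e :- 1ₚ
    uₚ d e  = d :* e :- 1ₚ
    wₚ d e  = d :- 1ₚ
    Hₚ d e  = powₚ d 3 :* powₚ e 2 :+ (1ₚ :- natₚ 3 :* d) :* e :+ 1ₚ
    c₁ₚ d e = powₚ d 3 :* e :* Hₚ d e
    γₚ d e  = d :* (d :* e :- natₚ 2 :* d :* (d :* e :+ 1ₚ) :+ d :* d :* (d :* e :* (d :* e) :+ d :* e :+ 1ₚ))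
    αₚ d e  = Dₚ d e :* uₚ d e
    βₚ d e  = d :* wₚ d e :* wₚ d e :+ uₚ d e :* γₚ d e

  open Syntax

  F-sym : ∀ x y → F x y ≈ F y x
  F-sym = solve 4 (λ d e x y → Fₚ d e x y := Fₚ d e y x) refl δ ε

  F[x,1] : ∀ x → F x 1# ≈ c₁ * x
  F[x,1] = solve 3 (λ d e x → Fₚ d e x 1ₚ := c₁ₚ d e :* x) refl δ ε

  F[0,1-s] : ∀ s → F 0# (1# - s) ≈ - (D * (s * (D * s + (w - D))))
  F[0,1-s] = solve 3 (λ d e s → Fₚ d e 0ₚ (1ₚ :- s)
                              := :- (Dₚ d e :* (s :* (Dₚ d e :* s :+ (wₚ d e :- Dₚ d e))))) refl δ ε

  F[x,1-x] : ∀ x → F x (1# - x) ≈ - ((x * x - x) * (α * (x * x - x) + β))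
  F[x,1-x] = solve 3 (λ d e x → Fₚ d e x (1ₚ :- x)
                              := :- ((x :* x :- x) :* (αₚ d e :* (x :* x :- x) :+ βₚ d e))) refl δ ε

  δ²ε≈D+1 : pow δ 2 * ε ≈ D + 1#
  δ²ε≈D+1 = solve 2 (λ d e → powₚ d 2 :* e := Dₚ d e :+ 1ₚ) refl δ ε

  D≈uw+u+w : D ≈ u * w + u + w
  D≈uw+u+w = solve 2 (λ d e → Dₚ d e := uₚ d e :* wₚ d e :+ uₚ d e :+ wₚ d e) refl δ ε

module NoLineInCurveQ {c ℓ} (K : Field c ℓ) where
  open Field K
  open FieldNotions K
  open FieldProperties K
  open IntegerCoefficientSolver commutativeRing using (solve; _:=_; _:+_; _:*_; _:-_; 0ₚ; 1ₚ)
  open import Relation.Binary.Reasoning.Setoid setoid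

  module _ (closed : AlgebraicallyClosed) (δ ε : Carrier) where
    open CurveQ K δ ε

    module _ (δ≉0 : ¬ δ ≈ 0#) (ε≉0 : ¬ ε ≈ 0#) (δ²ε≉1 : ¬ pow δ 2 * ε ≈ 1#) (H≉0 : ¬ H ≈ 0#) where

      D≉0 : ¬ D ≈ 0#
      D≉0 D≈0 = δ²ε≉1 (trans δ²ε≈D+1 (trans (+-congʳ D≈0) (+-identityˡ 1#)))

      c₁≉0 : ¬ c₁ ≈ 0#
      c₁≉0 = *-≉0 (*-≉0 (*-≉0 δ≉0 (*-≉0 δ≉0 (*-≉0 δ≉0 1≉0))) ε≉0) H≉0

      ContainsLine : Carrier → Carrier → Carrier → Set (c ⊔ ℓ)
      ContainsLine a b c₀ = ∀ x y → a * x + b * y + c₀ ≈ 0# → F x y ≈ 0#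

      ContainsLine-swap : ∀ {a b c₀} → ContainsLine a b c₀ → ContainsLine b a c₀
      ContainsLine-swap line x y on = trans (F-sym x y) (line y x (trans (+-congʳ (+-comm _ _)) on))

      ContainsLine⇒b+c≈0 : ∀ {a b c₀} → ¬ a ≈ 0# → ContainsLine a b c₀ → b + c₀ ≈ 0#
      ContainsLine⇒b+c≈0 {a} {b} {c₀} a≉0 line = begin
        b + c₀                  ≈⟨ solve 3 (λ a b c → b :+ c := a :* 0ₚ :+ b :* 1ₚ :+ c) refl a b c₀ ⟩
        a * 0# + b * 1# + c₀    ≈⟨ +-congʳ (+-congʳ (*-congˡ x≈0)) ⟨
        a * x + b * 1# + c₀     ≈⟨ on ⟩
        0#                      ∎
        where
        x = proj₁ (line-meets-every-horizontal b c₀ 1# a≉0)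
        on = proj₂ (line-meets-every-horizontal b c₀ 1# a≉0)
        x≈0 : x ≈ 0#
        x≈0 = *-cancelˡ-≉0 c₁≉0 (trans (sym (F[x,1] x)) (line x 1# on))

      no-line-x≡0 : ¬ (∀ y → F 0# y ≈ 0#)
      no-line-x≡0 vanishes = D≉0 (proj₁ (vanishing-quadratic closed (λ s →
        *-cancelˡ-≉0 D≉0 (-x≈0⇒x≈0 (trans (sym (F[0,1-s] s)) (vanishes (1# - s)))))))

      no-line-x+y≡1 : ¬ (∀ x → F x (1# - x) ≈ 0#)
      no-line-x+y≡1 vanishes = *-≉0 (*-≉0 δ≉0 w≉0) w≉0 δww≈0
        where
        quadratic-vanishes : ∀ s → s * (α * s + β) ≈ 0#
        quadratic-vanishes s with x²-x-surjective closed s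
        ... | x , x²-x≈s = begin
          s * (α * s + β)                         ≈⟨ *-cong x²-x≈s (+-congʳ (*-congˡ x²-x≈s)) ⟨
          (x * x - x) * (α * (x * x - x) + β)     ≈⟨ -x≈0⇒x≈0 (trans (sym (F[x,1-x] x)) (vanishes x)) ⟩
          0#                                      ∎

        α≈0×β≈0 = vanishing-quadratic closed quadratic-vanishes

        u≈0 : u ≈ 0#
        u≈0 = *-cancelˡ-≉0 D≉0 (proj₁ α≈0×β≈0)

        w≉0 : ¬ w ≈ 0#
        w≉0 w≈0 = D≉0 (begin
          D                  ≈⟨ D≈uw+u+w ⟩
          u * w + u + w      ≈⟨ +-cong (+-cong (*-cong u≈0 w≈0) u≈0) w≈0 ⟩
          0# * 0# + 0# + 0#  ≈⟨ solve 0 (0ₚ :* 0ₚ :+ 0ₚ :+ 0ₚ := 0ₚ) refl ⟩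
          0#                 ∎)

        δww≈0 : δ * w * w ≈ 0#
        δww≈0 = begin
          δ * w * w            ≈⟨ +-identityʳ _ ⟨
          δ * w * w + 0#       ≈⟨ +-congˡ (trans (*-congʳ u≈0) (zeroˡ γ)) ⟨
          δ * w * w + u * γ    ≈⟨ proj₂ α≈0×β≈0 ⟩
          0#                   ∎

      ¬ContainsLine-axis-parallel : ∀ {a b c₀} → ¬ a ≈ 0# → b ≈ 0# → ¬ ContainsLine a b c₀
      ¬ContainsLine-axis-parallel {a} {b} {c₀} a≉0 b≈0 line = no-line-x≡0 λ y → line 0# y (begin
        a * 0# + b * y + c₀    ≈⟨ +-cong (+-cong (zeroʳ a) (trans (*-congʳ b≈0) (zeroˡ y))) c₀≈0 ⟩
        0# + 0# + 0#           ≈⟨ solve 0 (0ₚ :+ 0ₚ :+ 0ₚ := 0ₚ) refl ⟩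
        0#                     ∎)
        where
        c₀≈0 : c₀ ≈ 0#
        c₀≈0 = trans (sym (+-identityˡ c₀))
                     (trans (+-congʳ (sym b≈0)) (ContainsLine⇒b+c≈0 a≉0 line))

      ¬ContainsLine-oblique : ∀ {a b c₀} → ¬ a ≈ 0# → ¬ b ≈ 0# → ¬ ContainsLine a b c₀
      ¬ContainsLine-oblique {a} {b} {c₀} a≉0 b≉0 line = no-line-x+y≡1 λ x → line x (1# - x) (begin
        a * x + b * (1# - x) + c₀               ≈⟨ solve 4 (λ a b c x → a :* x :+ b :* (1ₚ :- x) :+ c
                                                               := (a :+ c) :* x :+ (b :+ c) :* (1ₚ :- x)) refl a b c₀ x ⟩
        (a + c₀) * x + (b + c₀) * (1# - x)      ≈⟨ +-cong (*-congʳ a+c≈0) (*-congʳ b+c≈0) ⟩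
        0# * x + 0# * (1# - x)                  ≈⟨ solve 1 (λ x → 0ₚ :* x :+ 0ₚ :* (1ₚ :- x) := 0ₚ) refl x ⟩
        0#                                      ∎)
        where
        b+c≈0 = ContainsLine⇒b+c≈0 a≉0 line
        a+c≈0 = ContainsLine⇒b+c≈0 b≉0 (ContainsLine-swap line)

      ¬ContainsLine : ∀ {a b c₀} → ¬ (a ≈ 0# × b ≈ 0#) → ¬ ContainsLine a b c₀
      ¬ContainsLine ab≉0 line = ¬¬-excluded-middle λ where
        (yes a≈0) → ¬ContainsLine-axis-parallel (λ b≈0 → ab≉0 (a≈0 , b≈0)) a≈0 (ContainsLine-swap line)
        (no a≉0)  → ¬¬-excluded-middle λ where
          (yes b≈0) → ¬ContainsLine-axis-parallel a≉0 b≈0 line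
          (no b≉0)  → ¬ContainsLine-oblique a≉0 b≉0 line

lemma4p12 : ∀ {c ℓ : Level} (K : Field c ℓ) → let open Field K
                                                  open FieldNotions K in
  AlgebraicallyClosed → (p k : ℕ) → Prime p → HasCharacteristic p → 1 ≤ k →
  (δ ε : Carrier) → pow δ (p ^ k) ≈ δ → pow ε (p ^ k) ≈ ε →
  ¬ (δ ≈ 0#) → ¬ (ε ≈ 0#) →
  ¬ (pow δ 2 * ε ≈ 1#) →
  ¬ (pow δ 3 * pow ε 2 + (1# - nat 3 * δ) * ε + 1# ≈ 0#) →
  ¬ HasLinearComponent (fQ δ ε)
lemma4p12 K closed _ _ _ _ _ δ ε _ _ δ≉0 ε≉0 δ²ε≉1 H≉0 has-line =
  let a , b , c₀ , ab≉0 , F-vanishes = vanishes-on-linear-component fQ-supportedBelow-3 has-line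
  in ¬ContainsLine closed δ ε δ≉0 ε≉0 δ²ε≉1 H≉0 ab≉0 F-vanishes
  where
  open BivariateEvaluation K
  open CurveQ K δ ε
  open NoLineInCurveQ K
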